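{- Let $\mathcal B$ be a building set on a finite set $V$ and $B,B'\in\mathcal B$. Then $B$ and $B'$ are exchangeable if and only if there exist a block $P\in\mathcal B$ and vertices $v\in B\setminus B'$ and $v'\in B'\setminus B$ such that $B\subsetneq P$ and $B'\subsetneq P$, and $v'\in C$ for every block $C\in\mathcal B$ with $B\cap C\neq\varnothing$, $C\subseteq P$ and $C\not\subseteq B$, while $v\in C'$ for every block $C'\in\mathcal B$ with $B'\cap C'\neq\varnothing$, $C'\subseteq P$ and $C'\not\subseteq B'$.
   Context: A building set on $V$ is a set $\mathcal B$ of non-empty subsets of $V$ (blocks) containing all singletons such that $B\cap B'\ne\varnothing$ implies $B\cup B'\in\mathcal B$; $\kappa(\mathcal B)$ is its set of inclusion-maximal blocks. A $\mathcal B$-nested set is $\mathcal N\subseteq\mathcal B$ whose members are pairwise nested or disjoint, such that no union of $k\ge 2$ pairwise disjoint members belongs to $\mathcal B$, and with $\kappa(\mathcal B)\subseteq\mathcal N$. Two blocks $B,B'$ are exchangeable if there are inclusion-maximal nested sets $\mathcal N,\mathcal N'$ with $\mathcal N\setminus\{B\}=\mathcal N'\setminus\{B'\}$ and $B\ne B'$. -}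

module Defs where

open import Data.Bool using (Bool; true; false)
open import Data.Nat using (ℕ; _≤_)
open import Data.Fin using (Fin)
open import Data.Fin.Subset using (Subset; _∈_; _∉_; _⊆_; _⊂_; _∩_; _∪_; ⋃; ⁅_⁆; Nonempty; Empty)
open import Data.List using (List; length)
open import Data.List.Relation.Unary.All using (All)
open import Data.List.Relation.Unary.AllPairs using (AllPairs)
open import Data.Product using (Σ; ∃; _×_; _,_)
open import Data.Empty using (⊥)
open import Data.Sum using (_⊎_)
open import Relation.Binary.PropositionalEquality using (_≡_; _≢_)
open import Function.Bundles using (_⇔_)

Family : ℕ → Set
Family n = Subset n → Bool

_∈ᶠ_ : ∀ {n} → Subset n → Family n → Set
X ∈ᶠ F = F X ≡ true

infix 4 _∈ᶠ_

_⊆ᶠ_ : ∀ {n} → Family n → Family n → Set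
F ⊆ᶠ G = ∀ X → X ∈ᶠ F → X ∈ᶠ G

record IsBuildingSet {n : ℕ} (𝓑 : Family n) : Set where
  field
    blocks-nonempty : ∀ X → X ∈ᶠ 𝓑 → Nonempty X
    singletons      : ∀ (i : Fin n) → ⁅ i ⁆ ∈ᶠ 𝓑
    union-closed    : ∀ X Y → X ∈ᶠ 𝓑 → Y ∈ᶠ 𝓑 → Nonempty (X ∩ Y) → (X ∪ Y) ∈ᶠ 𝓑

IsMaximalBlock : ∀ {n} → Family n → Subset n → Set
IsMaximalBlock 𝓑 X = X ∈ᶠ 𝓑 × (∀ Y → Y ∈ᶠ 𝓑 → X ⊆ Y → Y ≡ X)

record IsNested {n : ℕ} (𝓑 : Family n) (𝓝 : Family n) : Set where
  field
    sub𝓑        : 𝓝 ⊆ᶠ 𝓑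
    nested-or-disjoint : ∀ X Y → X ∈ᶠ 𝓝 → Y ∈ᶠ 𝓝 → X ⊆ Y ⊎ Y ⊆ X ⊎ Empty (X ∩ Y)
    no-disjoint-union : ∀ (Xs : List (Subset n)) → 2 ≤ length Xs →
                        All (_∈ᶠ 𝓝) Xs → AllPairs (λ X Y → Empty (X ∩ Y)) Xs →
                        ⋃ Xs ∈ᶠ 𝓑 → ⊥
    contains-κ  : ∀ X → IsMaximalBlock 𝓑 X → X ∈ᶠ 𝓝

IsMaximalNested : ∀ {n} → Family n → Family n → Set
IsMaximalNested 𝓑 𝓝 = IsNested 𝓑 𝓝 × (∀ 𝓝' → IsNested 𝓑 𝓝' → 𝓝 ⊆ᶠ 𝓝' → 𝓝' ⊆ᶠ 𝓝)

Exchangeable : ∀ {n} → Family n → Subset n → Subset n → Set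
Exchangeable 𝓑 B B' =
  Σ _ λ 𝓝 → Σ _ λ 𝓝' →
    IsMaximalNested 𝓑 𝓝 × IsMaximalNested 𝓑 𝓝' ×
    B ∈ᶠ 𝓝 × B' ∈ᶠ 𝓝' ×
    (∀ X → (X ∈ᶠ 𝓝 × X ≢ B) ⇔ (X ∈ᶠ 𝓝' × X ≢ B')) ×
    B ≢ B'

module Submission where

-- A member X of a nested set has a label: a vertex of X lying in no smaller member (otherwise
-- X would be the disjoint union of its maximal proper submembers).  In a maximal nested set
-- the label is unique, since two labels x ≠ y would allow adding the component of x in X − y.
--
-- Let 𝓝 ∖ {B} = 𝓝' ∖ {B'} with 𝓝, 𝓝' maximal.  The parent P of B in 𝓝 (its
-- smallest strict superset there) contains B', as otherwise B could be added to 𝓝'; hence P is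
-- also the parent of B' in 𝓝'.  The vertices of P lying in no member of the common part strictly
-- below P are exactly the label p of P and the label v of B in 𝓝, and equally the label p' of P
-- and the label v' of B' in 𝓝'.  A shared label of B and B' would make B ∪ B' covered, so
-- v' = p and v = p'.  Finally a block C ⊆ P meeting B but not inside B contains p: otherwise
-- the component of v in P − p would contain C ∪ B and be covered by members of 𝓝.
--
-- With Q the vertices outside P and R the rest of P, the vertex orders
-- Q v' v R and Q v v' R give maximal nested sets (each vertex contributes its component among
-- the later vertices) which coincide except for the block of the second of v, v': by the two
-- covering conditions it is B in the first order and B' in the second.

open import Defs
open import Data.Nat using (ℕ; _≤_; s≤s; z≤n)
open import Data.Bool as Bool using (Bool; true; false; _∨_; _∧_; not)
open import Data.Bool.Properties using (∨-zeroʳ)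
open import Data.Fin using (Fin; _≟_)
open import Data.Fin.Properties using (any?)
open import Data.Fin.Subset
  using (Subset; outside; _∈_; _∉_; _⊆_; _⊈_; _⊂_; _⊃_; ⁅_⁆; _∩_; _∪_; _─_; _-_; ⋃; Nonempty; Empty)
  renaming (⊥ to ∅)
open import Data.Fin.Subset.Properties
  using (_∈?_; _⊆?_; _⊂?_; nonempty?; anySubset?; ⊆-refl; ⊆-trans; ⊆-antisym; p⊂q⇒p⊆q; ∉⊥; x∈⁅x⁆; x∈⁅y⁆⇒x≡y;
         x∈p∩q⁺; x∈p∩q⁻; x∈p∪q⁻; p⊆p∪q; q⊆p∪q; p─q⊆p; p∩q≢∅⇒p─q⊂p; x∈p∧x∉q⇒x∈p─q; x∈p∧x≢y⇒x∈p-y)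
open import Data.Vec using (_∷_; tabulate; here; there)
open import Data.Vec.Properties using (lookup∘tabulate; []=⇒lookup; lookup⇒[]=; ≡-dec)
open import Data.Fin.Subset.Induction using (⊂-wellFounded; ⊃-wellFounded)
open import Data.List using (List; []; _∷_; _++_; _∷ʳ_; length; filter; allFin)
open import Data.List.Properties using (++-assoc)
open import Data.List.Membership.Propositional using () renaming (_∈_ to _∈ˡ_)
open import Data.List.Membership.Propositional.Properties
  using (∈-++⁺ˡ; ∈-++⁺ʳ; ∈-++⁻; ∈-filter⁺; ∈-filter⁻; ∈-allFin)
open import Data.List.Relation.Unary.Any using (here; there)
open import Data.List.Relation.Unary.All as All using (All; []; _∷_)
open import Data.List.Relation.Unary.AllPairs using (AllPairs; []; _∷_)
open import Data.List.Relation.Unary.Unique.Propositional using (Unique)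
open import Data.List.Relation.Unary.Unique.Propositional.Properties using (++⁺; filter⁺; allFin⁺)
open import Data.Product using (Σ; Σ-syntax; ∃; _×_; _,_; proj₁; proj₂; uncurry)
open import Data.Sum using (_⊎_; inj₁; inj₂)
open import Data.Empty using (⊥; ⊥-elim)
open import Function using (_∘_; case_of_)
open import Function.Bundles using (_⇔_; mk⇔; Equivalence)
open import Function.Construct.Symmetry using (⇔-sym)
open import Relation.Unary using (Decidable)
open import Induction.WellFounded using (Acc; acc)
open import Relation.Nullary using (¬_; Dec; yes; no)
open import Relation.Nullary.Decidable using (does; dec-true; dec-false; decidable-stable; ¬?; _×-dec_)
open import Relation.Binary.PropositionalEquality
  using (_≡_; _≢_; refl; sym; trans; subst; cong; cong₂; module ≡-Reasoning)

∈-swap : ∀ {A : Set} (xs ys : List A) {b b' x : A} →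
         ¬ b' ∈ˡ xs ++ ys → x ∈ˡ xs ++ b ∷ ys → x ≢ b → x ∈ˡ xs ++ b' ∷ ys × x ≢ b'
∈-swap [] ys b'∉ (here refl) x≢b = ⊥-elim (x≢b refl)
∈-swap [] ys b'∉ (there x∈ys) x≢b = there x∈ys , λ { refl → b'∉ x∈ys }
∈-swap (z ∷ xs) ys b'∉ (here refl) x≢b = here refl , λ { refl → b'∉ (here refl) }
∈-swap (z ∷ xs) ys b'∉ (there x∈) x≢b =
  let x∈' , x≢b' = ∈-swap xs ys (b'∉ ∘ there) x∈ x≢b in there x∈' , x≢b'

x∈p─q⇒x∉q : ∀ {n} {x : Fin n} (p q : Subset n) → x ∈ p ─ q → x ∉ q
x∈p─q⇒x∉q (_ ∷ p) (outside ∷ q) here = λ ()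
x∈p─q⇒x∉q (_ ∷ p) (_ ∷ q) (there x∈p─q) (there x∈q) = x∈p─q⇒x∉q p q x∈p─q x∈q

module _ {n : ℕ} where

  _≟ˢ_ : (X Y : Subset n) → Dec (X ≡ Y)
  _≟ˢ_ = ≡-dec Bool._≟_

  _⊊_ : Subset n → Subset n → Set
  X ⊊ Y = X ⊆ Y × X ≢ Y

  infix 4 _⊊_

  _⊊?_ : (X Y : Subset n) → Dec (X ⊊ Y)
  X ⊊? Y = X ⊆? Y ×-dec ¬? (X ≟ˢ Y)

  ⊊-⊆-trans : {X Y Z : Subset n} → X ⊊ Y → Y ⊆ Z → X ⊊ Z
  ⊊-⊆-trans (X⊆Y , X≢Y) Y⊆Z =
    ⊆-trans X⊆Y Y⊆Z , λ { refl → X≢Y (⊆-antisym X⊆Y Y⊆Z) }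

  ⊆∧⊄⇒⊇ : {X Y : Subset n} → X ⊆ Y → ¬ X ⊂ Y → Y ⊆ X
  ⊆∧⊄⇒⊇ {X} X⊆Y X⊄Y {x} x∈Y =
    decidable-stable (x ∈? X) (λ x∉X → X⊄Y (X⊆Y , x , x∈Y , x∉X))

  ⊊⇒⊂ : {X Y : Subset n} → X ⊊ Y → X ⊂ Y
  ⊊⇒⊂ {X} {Y} (X⊆Y , X≢Y) =
    decidable-stable (X ⊂? Y) (λ X⊄Y → X≢Y (⊆-antisym X⊆Y (⊆∧⊄⇒⊇ X⊆Y X⊄Y)))

  ⊂⇒⊊ : {X Y : Subset n} → X ⊂ Y → X ⊊ Y
  ⊂⇒⊊ (X⊆Y , x , x∈Y , x∉X) = X⊆Y , λ { refl → x∉X x∈Y }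

  ∪-least : {X Y Z : Subset n} → X ⊆ Z → Y ⊆ Z → X ∪ Y ⊆ Z
  ∪-least {X} {Y} X⊆Z Y⊆Z x∈X∪Y with x∈p∪q⁻ X Y x∈X∪Y
  ... | inj₁ x∈X = X⊆Z x∈X
  ... | inj₂ x∈Y = Y⊆Z x∈Y

  ⁅x⁆⊆ : {x : Fin n} {X : Subset n} → x ∈ X → ⁅ x ⁆ ⊆ X
  ⁅x⁆⊆ {x} x∈X y∈⁅x⁆ = subst (_∈ _) (sym (x∈⁅y⁆⇒x≡y x y∈⁅x⁆)) x∈X

  ⊆-remove : {x : Fin n} {X Y : Subset n} → X ⊆ Y → x ∉ X → X ⊆ Y - x
  ⊆-remove X⊆Y x∉X z∈X = x∈p∧x≢y⇒x∈p-y (X⊆Y z∈X) λ { refl → x∉X z∈X }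

  nonempty-∩ : {x : Fin n} {X Y : Subset n} → x ∈ X → x ∈ Y → Nonempty (X ∩ Y)
  nonempty-∩ x∈X x∈Y = _ , x∈p∩q⁺ (x∈X , x∈Y)

  ∩-nonempty-comm : {X Y : Subset n} → Nonempty (X ∩ Y) → Nonempty (Y ∩ X)
  ∩-nonempty-comm {X} {Y} (x , x∈X∩Y) with x∈p∩q⁻ X Y x∈X∩Y
  ... | x∈X , x∈Y = nonempty-∩ x∈Y x∈X

  ∩-nonempty-monoʳ : {X Y Z : Subset n} → Y ⊆ Z → Nonempty (X ∩ Y) → Nonempty (X ∩ Z)
  ∩-nonempty-monoʳ {X} {Y} Y⊆Z (x , x∈X∩Y) with x∈p∩q⁻ X Y x∈X∩Y
  ... | x∈X , x∈Y = nonempty-∩ x∈X (Y⊆Z x∈Y)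

  Disjoint : Subset n → Subset n → Set
  Disjoint X Y = Empty (X ∩ Y)

  Disjoint-sym : {X Y : Subset n} → Disjoint X Y → Disjoint Y X
  Disjoint-sym X∩Y≡∅ = X∩Y≡∅ ∘ ∩-nonempty-comm

  disjoint-partner : ∀ {X} Xs → AllPairs Disjoint Xs → 2 ≤ length Xs → X ∈ˡ Xs →
                     Σ[ Y ∈ Subset n ] Y ∈ˡ Xs × Disjoint X Y
  disjoint-partner (_ ∷ []) _ (s≤s ()) _
  disjoint-partner (_ ∷ Y ∷ _) ((X∩Y≡∅ ∷ _) ∷ _) _ (here refl) = Y , there (here refl) , X∩Y≡∅
  disjoint-partner (Y ∷ _ ∷ _) (Y-disjoint ∷ _) _ (there X∈Xs) =
    Y , here refl , Disjoint-sym (All.lookup Y-disjoint X∈Xs)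

  ∈⋃⁻ : {x : Fin n} (Xs : List (Subset n)) → x ∈ ⋃ Xs → Σ[ X ∈ Subset n ] X ∈ˡ Xs × x ∈ X
  ∈⋃⁻ [] x∈∅ = ⊥-elim (∉⊥ x∈∅)
  ∈⋃⁻ (X ∷ Xs) x∈⋃ with x∈p∪q⁻ X (⋃ Xs) x∈⋃
  ... | inj₁ x∈X = X , here refl , x∈X
  ... | inj₂ x∈⋃Xs with ∈⋃⁻ Xs x∈⋃Xs
  ...   | Y , Y∈Xs , x∈Y = Y , there Y∈Xs , x∈Y

  ∈⋃⁺ : {x : Fin n} {X : Subset n} {Xs : List (Subset n)} → X ∈ˡ Xs → x ∈ X → x ∈ ⋃ Xs
  ∈⋃⁺ {X = X} (here refl) = p⊆p∪q _
  ∈⋃⁺ {Xs = Y ∷ _} (there X∈Xs) = q⊆p∪q Y _ ∘ ∈⋃⁺ X∈Xs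

  ⋃-least : {Z : Subset n} (Xs : List (Subset n)) → All (_⊆ Z) Xs → ⋃ Xs ⊆ Z
  ⋃-least [] [] x∈∅ = ⊥-elim (∉⊥ x∈∅)
  ⋃-least (X ∷ Xs) (X⊆Z ∷ Xs⊆Z) = ∪-least X⊆Z (⋃-least Xs Xs⊆Z)

  subsetOf : {P : Fin n → Set} → Decidable P → Subset n
  subsetOf P? = tabulate (does ∘ P?)

  ∈-subsetOf⁺ : {P : Fin n → Set} (P? : Decidable P) {x : Fin n} → P x → x ∈ subsetOf P?
  ∈-subsetOf⁺ P? {x} Px =
    lookup⇒[]= x _ (trans (lookup∘tabulate (does ∘ P?) x) (dec-true (P? x) Px))

  ∈-subsetOf⁻ : {P : Fin n → Set} (P? : Decidable P) {x : Fin n} → x ∈ subsetOf P? → P x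
  ∈-subsetOf⁻ P? {x} x∈ with P? x | trans (sym (lookup∘tabulate (does ∘ P?) x)) ([]=⇒lookup x∈)
  ... | yes Px | _ = Px
  ... | no _ | ()

  IsMaximal : (Subset n → Set) → Subset n → Set
  IsMaximal Q M = Q M × (∀ Z → Q Z → M ⊆ Z → Z ⊆ M)

  IsMinimal : (Subset n → Set) → Subset n → Set
  IsMinimal Q M = Q M × (∀ Z → Q Z → Z ⊆ M → M ⊆ Z)

  maximal-above : {Q : Subset n → Set} → Decidable Q → {Y : Subset n} → Q Y →
    Σ[ M ∈ Subset n ] Y ⊆ M × IsMaximal Q M
  maximal-above {Q} Q? = go (⊃-wellFounded _)
    where
    go : ∀ {Y} → Acc _⊃_ Y → Q Y → Σ[ M ∈ Subset n ] Y ⊆ M × IsMaximal Q M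
    go {Y} (acc larger) QY with anySubset? (λ Z → Q? Z ×-dec Y ⊂? Z)
    ... | yes (Z , QZ , Y⊂Z) =
      let M , Z⊆M , M-max = go (larger Y⊂Z) QZ in M , ⊆-trans (p⊂q⇒p⊆q Y⊂Z) Z⊆M , M-max
    ... | no ∄Z = Y , ⊆-refl , QY , λ Z QZ Y⊆Z → ⊆∧⊄⇒⊇ Y⊆Z (λ Y⊂Z → ∄Z (Z , QZ , Y⊂Z))

  minimal-below : {Q : Subset n → Set} → Decidable Q → {Y : Subset n} → Q Y →
    Σ[ M ∈ Subset n ] M ⊆ Y × IsMinimal Q M
  minimal-below {Q} Q? = go (⊂-wellFounded _)
    where
    go : ∀ {Y} → Acc _⊂_ Y → Q Y → Σ[ M ∈ Subset n ] M ⊆ Y × IsMinimal Q M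
    go {Y} (acc smaller) QY with anySubset? (λ Z → Q? Z ×-dec Z ⊂? Y)
    ... | yes (Z , QZ , Z⊂Y) =
      let M , M⊆Z , M-min = go (smaller Z⊂Y) QZ in M , ⊆-trans M⊆Z (p⊂q⇒p⊆q Z⊂Y) , M-min
    ... | no ∄Z = Y , ⊆-refl , QY , λ Z QZ Z⊆Y → ⊆∧⊄⇒⊇ Z⊆Y (λ Z⊂Y → ∄Z (Z , QZ , Z⊂Y))

module _ {n : ℕ} where
  open import Data.List.Membership.DecPropositional (_≟ˢ_ {n}) using () renaming (_∈?_ to _∈ˡ?_)

  subsetOfList : List (Fin n) → Subset n
  subsetOfList [] = ∅
  subsetOfList (x ∷ xs) = ⁅ x ⁆ ∪ subsetOfList xs

  ∈-subsetOfList⁺ : {z : Fin n} {xs : List (Fin n)} → z ∈ˡ xs → z ∈ subsetOfList xs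
  ∈-subsetOfList⁺ (here refl) = p⊆p∪q _ (x∈⁅x⁆ _)
  ∈-subsetOfList⁺ (there z∈xs) = q⊆p∪q _ _ (∈-subsetOfList⁺ z∈xs)

  ∈-subsetOfList⁻ : {z : Fin n} (xs : List (Fin n)) → z ∈ subsetOfList xs → z ∈ˡ xs
  ∈-subsetOfList⁻ [] z∈∅ = ⊥-elim (∉⊥ z∈∅)
  ∈-subsetOfList⁻ (x ∷ xs) z∈ with x∈p∪q⁻ ⁅ x ⁆ (subsetOfList xs) z∈
  ... | inj₁ z∈⁅x⁆ = here (x∈⁅y⁆⇒x≡y x z∈⁅x⁆)
  ... | inj₂ z∈xs = there (∈-subsetOfList⁻ xs z∈xs)

  x∈subsetOfList : ∀ (x : Fin n) xs → x ∈ subsetOfList (x ∷ xs)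
  x∈subsetOfList x xs = ∈-subsetOfList⁺ {xs = x ∷ xs} (here refl)

  ⊆-subsetOfList-drop : {x : Fin n} {xs : List (Fin n)} {X : Subset n} →
    x ∉ X → X ⊆ subsetOfList (x ∷ xs) → X ⊆ subsetOfList xs
  ⊆-subsetOfList-drop {x} {xs} x∉X X⊆xxs {z} z∈X with x∈p∪q⁻ ⁅ x ⁆ (subsetOfList xs) (X⊆xxs z∈X)
  ... | inj₁ z∈⁅x⁆ = ⊥-elim (x∉X (subst (_∈ _) (x∈⁅y⁆⇒x≡y x z∈⁅x⁆) z∈X))
  ... | inj₂ z∈xs = z∈xs

  _++ˢ_ : List (Fin n) → Subset n → Subset n
  [] ++ˢ S = S
  (q ∷ Q) ++ˢ S = ⁅ q ⁆ ∪ (Q ++ˢ S)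

  subsetOfList-++ : ∀ Q ys → subsetOfList (Q ++ ys) ≡ Q ++ˢ subsetOfList ys
  subsetOfList-++ [] ys = refl
  subsetOfList-++ (q ∷ Q) ys = cong (⁅ q ⁆ ∪_) (subsetOfList-++ Q ys)

  familyOf : List (Subset n) → Family n
  familyOf L X = does (X ∈ˡ? L)

  ∈-familyOf⁺ : {L : List (Subset n)} {X : Subset n} → X ∈ˡ L → X ∈ᶠ familyOf L
  ∈-familyOf⁺ {L} {X} X∈L = dec-true (X ∈ˡ? L) X∈L

  ∈-familyOf⁻ : (L : List (Subset n)) {X : Subset n} → X ∈ᶠ familyOf L → X ∈ˡ L
  ∈-familyOf⁻ L {X} X∈F with X ∈ˡ? L
  ... | yes X∈L = X∈L
  ∈-familyOf⁻ L {X} () | no _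

  infixl 25 _∪ᶠ_ _∖ᶠ_

  _∪ᶠ_ : Family n → Subset n → Family n
  (F ∪ᶠ Z) X = F X ∨ does (X ≟ˢ Z)

  _∖ᶠ_ : Family n → Subset n → Family n
  (F ∖ᶠ Z) X = F X ∧ not (does (X ≟ˢ Z))

  ∈-∪ᶠ⁺ˡ : {F : Family n} {Z X : Subset n} → X ∈ᶠ F → X ∈ᶠ F ∪ᶠ Z
  ∈-∪ᶠ⁺ˡ X∈F rewrite X∈F = refl

  ∈-∪ᶠ⁺ʳ : {F : Family n} {Z : Subset n} → Z ∈ᶠ F ∪ᶠ Z
  ∈-∪ᶠ⁺ʳ {F} {Z} rewrite dec-true (Z ≟ˢ Z) refl = ∨-zeroʳ (F Z)

  ∈-∪ᶠ⁻ : {F : Family n} {Z X : Subset n} → X ∈ᶠ F ∪ᶠ Z → X ∈ᶠ F ⊎ X ≡ Z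
  ∈-∪ᶠ⁻ {F} {Z} {X} X∈ with F X | X ≟ˢ Z
  ... | true | _ = inj₁ refl
  ... | false | yes X≡Z = inj₂ X≡Z
  ∈-∪ᶠ⁻ {F} {Z} {X} () | false | no _

  ∈-∖ᶠ⁺ : {F : Family n} {Z X : Subset n} → X ∈ᶠ F → X ≢ Z → X ∈ᶠ F ∖ᶠ Z
  ∈-∖ᶠ⁺ {F} {Z} {X} X∈F X≢Z rewrite X∈F | dec-false (X ≟ˢ Z) X≢Z = refl

  ∈-∖ᶠ⁻ : {F : Family n} {Z X : Subset n} → X ∈ᶠ F ∖ᶠ Z → X ∈ᶠ F × X ≢ Z
  ∈-∖ᶠ⁻ {F} {Z} {X} X∈ with F X | X ≟ˢ Z
  ... | true | no X≢Z = refl , X≢Z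
  ∈-∖ᶠ⁻ {F} {Z} {X} () | true | yes _
  ∈-∖ᶠ⁻ {F} {Z} {X} () | false | _

_∈ᶠ?_ : ∀ {n} (X : Subset n) (F : Family n) → Dec (X ∈ᶠ F)
X ∈ᶠ? F = F X Bool.≟ true

module BuildingSetFacts {n : ℕ} (𝓑 : Family n) (𝓑-building : IsBuildingSet 𝓑) where
  open IsBuildingSet 𝓑-building

  -- Nested sets as laminar families of blocks none of which is covered by smaller members

  InProperMember : Family n → Subset n → Fin n → Set
  InProperMember F U x = Σ[ Y ∈ Subset n ] Y ∈ᶠ F × Y ⊊ U × x ∈ Y

  inProperMember? : ∀ F U x → Dec (InProperMember F U x)
  inProperMember? F U x = anySubset? λ Y → Y ∈ᶠ? F ×-dec (Y ⊊? U ×-dec x ∈? Y)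

  CoveredBy : Family n → Subset n → Set
  CoveredBy F U = ∀ {x} → x ∈ U → InProperMember F U x

  NoCoveredBlock : Family n → Set
  NoCoveredBlock F = ∀ U → U ∈ᶠ 𝓑 → ¬ CoveredBy F U

  module _ {F : Family n} (F-nested : IsNested 𝓑 F) {U : Subset n} where
    open IsNested F-nested

    MaximalBelow : Subset n → Set
    MaximalBelow = IsMaximal λ Y → Y ∈ᶠ F × Y ⊊ U

    maximalBelow-⊆-or-disjoint : ∀ {Y Z} → MaximalBelow Y → MaximalBelow Z → Z ⊆ Y ⊎ Disjoint Y Z
    maximalBelow-⊆-or-disjoint {Y} {Z} (QY , Y-max) (QZ , _) with nested-or-disjoint Y Z (proj₁ QY) (proj₁ QZ)
    ... | inj₁ Y⊆Z = inj₁ (Y-max Z QZ Y⊆Z)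
    ... | inj₂ (inj₁ Z⊆Y) = inj₁ Z⊆Y
    ... | inj₂ (inj₂ Y∩Z≡∅) = inj₂ Y∩Z≡∅

    DisjointMaximalCover : Subset n → Set
    DisjointMaximalCover T = Σ[ L ∈ List (Subset n) ]
      All MaximalBelow L × All (λ Y → Nonempty (Y ∩ T)) L × AllPairs Disjoint L × T ⊆ ⋃ L

    disjointMaximalCover : CoveredBy F U → ∀ {T} → T ⊆ U → DisjointMaximalCover T
    disjointMaximalCover U-covered = go (⊂-wellFounded _)
      where
      go : ∀ {T} → Acc _⊂_ T → T ⊆ U → DisjointMaximalCover T
      go {T} (acc smaller) T⊆U with nonempty? T
      ... | no T≡∅ = [] , [] , [] , [] , λ x∈T → ⊥-elim (T≡∅ (_ , x∈T))
      ... | yes (x , x∈T) =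
        let Y₀ , Y₀∈F , Y₀⊊U , x∈Y₀ = U-covered (T⊆U x∈T)
            Y , Y₀⊆Y , Y-max = maximal-above (λ Y → Y ∈ᶠ? F ×-dec Y ⊊? U) (Y₀∈F , Y₀⊊U)
            x∈Y = Y₀⊆Y x∈Y₀
            L , L-max , L-meet , L-disjoint , T─Y⊆⋃L =
              go (smaller (p∩q≢∅⇒p─q⊂p T Y (nonempty-∩ x∈T x∈Y))) (⊆-trans (p─q⊆p T Y) T⊆U)
        in  Y ∷ L , Y-max ∷ L-max ,
            nonempty-∩ x∈Y x∈T ∷ All.map (∩-nonempty-monoʳ (p─q⊆p T Y)) L-meet ,
            All.zipWith (disjoint-from-Y Y-max) (L-max , L-meet) ∷ L-disjoint ,
            cover {Y} {L} T─Y⊆⋃L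
        where
        disjoint-from-Y : ∀ {Y Z} → MaximalBelow Y → MaximalBelow Z × Nonempty (Z ∩ (T ─ Y)) → Disjoint Y Z
        disjoint-from-Y {Y} {Z} Y-max (Z-max , z , z∈Z∩T─Y) with maximalBelow-⊆-or-disjoint Y-max Z-max
        ... | inj₂ Y∩Z≡∅ = Y∩Z≡∅
        ... | inj₁ Z⊆Y =
          let z∈Z , z∈T─Y = x∈p∩q⁻ Z (T ─ Y) z∈Z∩T─Y in ⊥-elim (x∈p─q⇒x∉q T Y z∈T─Y (Z⊆Y z∈Z))

        cover : ∀ {Y L} → T ─ Y ⊆ ⋃ L → T ⊆ Y ∪ ⋃ L
        cover {Y} T─Y⊆⋃L {t} t∈T with t ∈? Y
        ... | yes t∈Y = p⊆p∪q _ t∈Y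
        ... | no t∉Y = q⊆p∪q Y _ (T─Y⊆⋃L (x∈p∧x∉q⇒x∈p─q t∈T t∉Y))

  nested⇒noCoveredBlock : {F : Family n} → IsNested 𝓑 F → NoCoveredBlock F
  nested⇒noCoveredBlock F-nested U U∈𝓑 U-covered with disjointMaximalCover F-nested U-covered ⊆-refl
  ... | [] , _ , _ , _ , U⊆∅ = let u , u∈U = blocks-nonempty U U∈𝓑 in ∉⊥ (U⊆∅ u∈U)
  ... | Y ∷ [] , ((_ , Y⊆U , Y≢U) , _) ∷ [] , _ , _ , U⊆⋃L =
    Y≢U (⊆-antisym Y⊆U (⊆-trans U⊆⋃L (⋃-least (Y ∷ []) (⊆-refl ∷ []))))
  ... | L@(_ ∷ _ ∷ _) , L-max , _ , L-disjoint , U⊆⋃L =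
    IsNested.no-disjoint-union F-nested L (s≤s (s≤s z≤n)) (All.map (proj₁ ∘ proj₁) L-max) L-disjoint
      (subst (_∈ᶠ 𝓑) (⊆-antisym U⊆⋃L (⋃-least L (All.map (proj₁ ∘ proj₂ ∘ proj₁) L-max))) U∈𝓑)

  noCoveredBlock⇒nested : {F : Family n} → F ⊆ᶠ 𝓑 →
    (∀ X Y → X ∈ᶠ F → Y ∈ᶠ F → X ⊆ Y ⊎ Y ⊆ X ⊎ Disjoint X Y) →
    NoCoveredBlock F → (∀ X → IsMaximalBlock 𝓑 X → X ∈ᶠ F) → IsNested 𝓑 F
  noCoveredBlock⇒nested {F} F⊆𝓑 F-laminar F-uncovering κ⊆F = record
    { sub𝓑 = F⊆𝓑 ; nested-or-disjoint = F-laminar ; no-disjoint-union = no-disjoint-union ; contains-κ = κ⊆F }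
    where
    no-disjoint-union : ∀ Xs → 2 ≤ length Xs → All (_∈ᶠ F) Xs → AllPairs Disjoint Xs → ⋃ Xs ∈ᶠ 𝓑 → ⊥
    no-disjoint-union Xs 2≤∣Xs∣ Xs⊆F Xs-disjoint ⋃Xs∈𝓑 = F-uncovering (⋃ Xs) ⋃Xs∈𝓑 covered
      where
      covered : CoveredBy F (⋃ Xs)
      covered x∈⋃Xs =
        let X , X∈Xs , x∈X = ∈⋃⁻ Xs x∈⋃Xs
            Y , Y∈Xs , X∩Y≡∅ = disjoint-partner Xs Xs-disjoint 2≤∣Xs∣ X∈Xs
            y , y∈Y = blocks-nonempty Y (F⊆𝓑 Y (All.lookup Xs⊆F Y∈Xs))
            X≢⋃Xs X≡⋃Xs = X∩Y≡∅ (nonempty-∩ (subst (y ∈_) (sym X≡⋃Xs) (∈⋃⁺ Y∈Xs y∈Y)) y∈Y)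
        in  X , All.lookup Xs⊆F X∈Xs , (∈⋃⁺ X∈Xs , X≢⋃Xs) , x∈X

  -- Connected components

  JoinedWithin : Subset n → Fin n → Fin n → Set
  JoinedWithin S x y = Σ[ C ∈ Subset n ] C ∈ᶠ 𝓑 × x ∈ C × y ∈ C × C ⊆ S

  joinedWithin? : ∀ S x y → Dec (JoinedWithin S x y)
  joinedWithin? S x y = anySubset? λ C → C ∈ᶠ? 𝓑 ×-dec (x ∈? C ×-dec (y ∈? C ×-dec C ⊆? S))

  component : Fin n → Subset n → Subset n
  component x S = subsetOf (joinedWithin? S x)

  component-maximal : ∀ {x S C} → C ∈ᶠ 𝓑 → x ∈ C → C ⊆ S → C ⊆ component x S
  component-maximal {x} {S} C∈𝓑 x∈C C⊆S y∈C = ∈-subsetOf⁺ (joinedWithin? S x) (_ , C∈𝓑 , x∈C , y∈C , C⊆S)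

  component-⊆ : ∀ {x S} → component x S ⊆ S
  component-⊆ {x} {S} y∈K with ∈-subsetOf⁻ (joinedWithin? S x) y∈K
  ... | _ , _ , _ , y∈C , C⊆S = C⊆S y∈C

  x∈component : ∀ {x S} → x ∈ S → x ∈ component x S
  x∈component {x} x∈S = component-maximal (singletons x) (x∈⁅x⁆ x) (⁅x⁆⊆ x∈S) (x∈⁅x⁆ x)

  component-block : ∀ {x S} → x ∈ S → component x S ∈ᶠ 𝓑
  component-block {x} {S} x∈S
    with maximal-above (λ C → C ∈ᶠ? 𝓑 ×-dec (x ∈? C ×-dec C ⊆? S)) (singletons x , x∈⁅x⁆ x , ⁅x⁆⊆ x∈S)
  ... | M , _ , (M∈𝓑 , x∈M , M⊆S) , M-max =
    subst (_∈ᶠ 𝓑) (⊆-antisym (component-maximal M∈𝓑 x∈M M⊆S) component⊆M) M∈𝓑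
    where
    component⊆M : component x S ⊆ M
    component⊆M y∈K with ∈-subsetOf⁻ (joinedWithin? S x) y∈K
    ... | C , C∈𝓑 , x∈C , y∈C , C⊆S =
      M-max (C ∪ M) (union-closed C M C∈𝓑 M∈𝓑 (nonempty-∩ x∈C x∈M) , q⊆p∪q C M x∈M , ∪-least C⊆S M⊆S)
        (q⊆p∪q C M) (p⊆p∪q M y∈C)

  component-absorbs : ∀ {x S Y} → x ∈ S → Y ∈ᶠ 𝓑 → Y ⊆ S → Nonempty (Y ∩ component x S) → Y ⊆ component x S
  component-absorbs {x} {S} {Y} x∈S Y∈𝓑 Y⊆S Y∩K≢∅ =
    ⊆-trans (p⊆p∪q _) (component-maximal (union-closed Y _ Y∈𝓑 (component-block x∈S) Y∩K≢∅)
                                         (q⊆p∪q Y _ (x∈component x∈S)) (∪-least Y⊆S component-⊆))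

  component-of-block : ∀ {x P} → P ∈ᶠ 𝓑 → x ∈ P → component x P ≡ P
  component-of-block P∈𝓑 x∈P = ⊆-antisym component-⊆ (component-maximal P∈𝓑 x∈P ⊆-refl)

  -- Adding a block to a nested set

  InProperMember-mono : ∀ {F G U x} → (∀ {Y} → Y ∈ᶠ F → Y ⊊ U → Y ∈ᶠ G) →
                        InProperMember F U x → InProperMember G U x
  InProperMember-mono F⊆G (Y , Y∈F , Y⊊U , x∈Y) = Y , F⊆G Y∈F Y⊊U , Y⊊U , x∈Y

  CoveredBy-mono : ∀ {F G U} → (∀ {Y} → Y ∈ᶠ F → Y ⊊ U → Y ∈ᶠ G) → CoveredBy F U → CoveredBy G U
  CoveredBy-mono F⊆G U-covered = InProperMember-mono F⊆G ∘ U-covered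

  enlarge-inserted : ∀ {F Z U} → (Z ⊊ U → Σ[ W ∈ Subset n ] W ∈ᶠ F × W ⊊ U × Z ⊆ W) →
                     CoveredBy (F ∪ᶠ Z) U → CoveredBy F U
  enlarge-inserted {F} {Z} enlarge U-covered x∈U with U-covered x∈U
  ... | Y , Y∈F∪Z , Y⊊U , x∈Y with ∈-∪ᶠ⁻ {F = F} Y∈F∪Z
  ...   | inj₁ Y∈F = Y , Y∈F , Y⊊U , x∈Y
  ...   | inj₂ refl = let W , W∈F , W⊊U , Z⊆W = enlarge Y⊊U in W , W∈F , W⊊U , Z⊆W x∈Y

  covered-∪ : ∀ {F Z A U} → A ∈ᶠ F → Z ⊆ A → U ⊈ A → CoveredBy (F ∪ᶠ Z) U → CoveredBy F (U ∪ A)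
  covered-∪ {F} {Z} {A} {U} A∈F Z⊆A U⊈A U-covered {w} w∈U∪A with w ∈? A
  ... | yes w∈A = A , A∈F , (q⊆p∪q U A , λ A≡U∪A → U⊈A (subst (U ⊆_) (sym A≡U∪A) (p⊆p∪q A))) , w∈A
  ... | no w∉A with x∈p∪q⁻ U A w∈U∪A
  ...   | inj₂ w∈A = ⊥-elim (w∉A w∈A)
  ...   | inj₁ w∈U with U-covered w∈U
  ...     | Y , Y∈F∪Z , Y⊊U , w∈Y with ∈-∪ᶠ⁻ {F = F} Y∈F∪Z
  ...       | inj₁ Y∈F = Y , Y∈F , ⊊-⊆-trans Y⊊U (p⊆p∪q A) , w∈Y
  ...       | inj₂ refl = ⊥-elim (w∉A (Z⊆A w∈Y))

  insert-nested : ∀ {F Z} → IsNested 𝓑 F → Z ∈ᶠ 𝓑 →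
    (∀ Y → Y ∈ᶠ F → Z ⊆ Y ⊎ Y ⊆ Z ⊎ Disjoint Z Y) →
    (∀ U → U ∈ᶠ 𝓑 → Z ⊊ U → ¬ CoveredBy (F ∪ᶠ Z) U) → IsNested 𝓑 (F ∪ᶠ Z)
  insert-nested {F} {Z} F-nested Z∈𝓑 Z-laminar Z-uncovering =
    noCoveredBlock⇒nested F∪Z⊆𝓑 laminar uncovering (λ K K-max → ∈-∪ᶠ⁺ˡ {F = F} (contains-κ K K-max))
    where
    open IsNested F-nested
    F∪Z⊆𝓑 : F ∪ᶠ Z ⊆ᶠ 𝓑
    F∪Z⊆𝓑 Y Y∈ with ∈-∪ᶠ⁻ {F = F} Y∈
    ... | inj₁ Y∈F = sub𝓑 Y Y∈F
    ... | inj₂ refl = Z∈𝓑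

    laminar : ∀ X Y → X ∈ᶠ F ∪ᶠ Z → Y ∈ᶠ F ∪ᶠ Z → X ⊆ Y ⊎ Y ⊆ X ⊎ Disjoint X Y
    laminar X Y X∈ Y∈ with ∈-∪ᶠ⁻ {F = F} X∈ | ∈-∪ᶠ⁻ {F = F} Y∈
    ... | inj₁ X∈F | inj₁ Y∈F = nested-or-disjoint X Y X∈F Y∈F
    ... | inj₂ refl | inj₂ refl = inj₁ ⊆-refl
    ... | inj₂ refl | inj₁ Y∈F = Z-laminar Y Y∈F
    ... | inj₁ X∈F | inj₂ refl with Z-laminar X X∈F
    ...   | inj₁ Z⊆X = inj₂ (inj₁ Z⊆X)
    ...   | inj₂ (inj₁ X⊆Z) = inj₁ X⊆Z
    ...   | inj₂ (inj₂ Z∩X≡∅) = inj₂ (inj₂ (Disjoint-sym Z∩X≡∅))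

    uncovering : NoCoveredBlock (F ∪ᶠ Z)
    uncovering U U∈𝓑 U-covered with Z ⊊? U
    ... | yes Z⊊U = Z-uncovering U U∈𝓑 Z⊊U U-covered
    ... | no ¬Z⊊U = nested⇒noCoveredBlock F-nested U U∈𝓑
                     (enlarge-inserted (λ Z⊊U → ⊥-elim (¬Z⊊U Z⊊U)) U-covered)

  maximal-absorbs : ∀ {F Z} → IsMaximalNested 𝓑 F → IsNested 𝓑 (F ∪ᶠ Z) → Z ∈ᶠ F
  maximal-absorbs {F} {Z} (_ , F-maximal) F∪Z-nested =
    F-maximal (F ∪ᶠ Z) F∪Z-nested (λ _ → ∈-∪ᶠ⁺ˡ {F = F}) Z (∈-∪ᶠ⁺ʳ {F = F})

  -- Labels

  IsLabel : Family n → Subset n → Fin n → Set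
  IsLabel F X x = x ∈ X × ¬ InProperMember F X x

  label-exists : ∀ {F X} → IsNested 𝓑 F → X ∈ᶠ F → Σ[ x ∈ Fin n ] IsLabel F X x
  label-exists {F} {X} F-nested X∈F with any? (λ x → x ∈? X ×-dec ¬? (inProperMember? F X x))
  ... | yes label = label
  ... | no ∄label = ⊥-elim (nested⇒noCoveredBlock F-nested X (IsNested.sub𝓑 F-nested X X∈F) X-covered)
    where
    X-covered : CoveredBy F X
    X-covered {x} x∈X = decidable-stable (inProperMember? F X x) λ x-uncovered → ∄label (x , x∈X , x-uncovered)

  nonLabel-covered : ∀ {F X x} → x ∈ X → ¬ IsLabel F X x → InProperMember F X x
  nonLabel-covered {F} {X} {x} x∈X ¬label =
    decidable-stable (inProperMember? F X x) λ x-uncovered → ¬label (x∈X , x-uncovered)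

  label-unique : ∀ {F X x y} → IsMaximalNested 𝓑 F → X ∈ᶠ F → IsLabel F X x → IsLabel F X y → x ≡ y
  label-unique {F} {X} {x} {y} F-max@(F-nested , _) X∈F (x∈X , x-label) (y∈X , y-label) =
    decidable-stable (x ≟ y) λ x≢y → x-label (split-off x≢y)
    where
    open IsNested F-nested

    below-avoids-y : ∀ {Y} → Y ∈ᶠ F → Y ⊊ X → Y ⊆ X - y
    below-avoids-y Y∈F Y⊊X = ⊆-remove (proj₁ Y⊊X) λ y∈Y → y-label (_ , Y∈F , Y⊊X , y∈Y)

    split-off : x ≢ y → InProperMember F X x
    split-off x≢y = Z , maximal-absorbs F-max (insert-nested F-nested (component-block x∈X-y) Z-laminar Z-uncovering) ,
                    (Z⊆X , λ Z≡X → y∉Z (subst (y ∈_) (sym Z≡X) y∈X)) , x∈component x∈X-y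
      where
      x∈X-y : x ∈ X - y
      x∈X-y = x∈p∧x≢y⇒x∈p-y x∈X x≢y

      Z : Subset n
      Z = component x (X - y)

      Z⊆X : Z ⊆ X
      Z⊆X = p─q⊆p X ⁅ y ⁆ ∘ component-⊆

      y∉Z : y ∉ Z
      y∉Z y∈Z = x∈p─q⇒x∉q X ⁅ y ⁆ (component-⊆ y∈Z) (x∈⁅x⁆ y)

      Z-laminar : ∀ Y → Y ∈ᶠ F → Z ⊆ Y ⊎ Y ⊆ Z ⊎ Disjoint Z Y
      Z-laminar Y Y∈F with nested-or-disjoint Y X Y∈F X∈F
      ... | inj₂ (inj₁ X⊆Y) = inj₁ (⊆-trans Z⊆X X⊆Y)
      ... | inj₂ (inj₂ Y∩X≡∅) = inj₂ (inj₂ (Disjoint-sym (Y∩X≡∅ ∘ ∩-nonempty-monoʳ Z⊆X)))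
      ... | inj₁ Y⊆X with Y ≟ˢ X
      ...   | yes refl = inj₁ Z⊆X
      ...   | no Y≢X with nonempty? (Y ∩ Z)
      ...     | yes Y∩Z≢∅ =
        inj₂ (inj₁ (component-absorbs x∈X-y (sub𝓑 Y Y∈F) (below-avoids-y Y∈F (Y⊆X , Y≢X)) Y∩Z≢∅))
      ...     | no Y∩Z≡∅ = inj₂ (inj₂ (Y∩Z≡∅ ∘ ∩-nonempty-comm))

      Z-uncovering : ∀ U → U ∈ᶠ 𝓑 → Z ⊊ U → ¬ CoveredBy (F ∪ᶠ Z) U
      Z-uncovering U U∈𝓑 (Z⊆U , Z≢U) U-covered with U ⊆? X
      ... | no U⊈X = nested⇒noCoveredBlock F-nested (U ∪ X)
                       (union-closed U X U∈𝓑 (sub𝓑 X X∈F) (nonempty-∩ (Z⊆U (x∈component x∈X-y)) x∈X))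
                       (covered-∪ X∈F Z⊆X U⊈X U-covered)
      ... | yes U⊆X with U-covered y∈U
        where
        y∈U : y ∈ U
        y∈U = decidable-stable (y ∈? U) λ y∉U → Z≢U (⊆-antisym Z⊆U
          (component-maximal U∈𝓑 (Z⊆U (x∈component x∈X-y)) (⊆-remove U⊆X y∉U)))
      ...   | Y , Y∈F∪Z , Y⊊U , y∈Y with ∈-∪ᶠ⁻ {F = F} Y∈F∪Z
      ...     | inj₁ Y∈F = y-label (Y , Y∈F , ⊊-⊆-trans Y⊊U U⊆X , y∈Y)
      ...     | inj₂ refl = y∉Z y∈Y

  union-not-covered : ∀ {F B B' w} → IsNested 𝓑 F → B ∈ᶠ F → B' ∈ᶠ 𝓑 → w ∈ B → w ∈ B' → B' ⊈ B →
                      (∀ {x} → x ∈ B' → x ∉ B → InProperMember F B' x) → ⊥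
  union-not-covered {F} {B} {B'} F-nested B∈F B'∈𝓑 w∈B w∈B' B'⊈B B'-covered =
    nested⇒noCoveredBlock F-nested (B ∪ B') (union-closed B B' B∈𝓑 B'∈𝓑 (nonempty-∩ w∈B w∈B')) covered
    where
    B∈𝓑 = IsNested.sub𝓑 F-nested B B∈F
    covered : CoveredBy F (B ∪ B')
    covered {x} x∈B∪B' with x ∈? B | x∈p∪q⁻ B B' x∈B∪B'
    ... | yes x∈B | _ = B , B∈F , (p⊆p∪q B' , λ B≡B∪B' → B'⊈B (subst (B' ⊆_) (sym B≡B∪B') (q⊆p∪q B B'))) , x∈B
    ... | no x∉B | inj₁ x∈B = ⊥-elim (x∉B x∈B)
    ... | no x∉B | inj₂ x∈B' =
      let Y , Y∈F , Y⊊B' , x∈Y = B'-covered x∈B' x∉B in Y , Y∈F , ⊊-⊆-trans Y⊊B' (q⊆p∪q B B') , x∈Y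

  maximalBlock-above : ∀ {X} → X ∈ᶠ 𝓑 → Σ[ K ∈ Subset n ] X ⊆ K × IsMaximalBlock 𝓑 K
  maximalBlock-above X∈𝓑 =
    let K , X⊆K , K∈𝓑 , K-max = maximal-above (_∈ᶠ? 𝓑) X∈𝓑
    in  K , X⊆K , K∈𝓑 , λ Y Y∈𝓑 K⊆Y → ⊆-antisym (K-max Y Y∈𝓑 K⊆Y) K⊆Y

  ExchangeCondition : Subset n → Subset n → Set
  ExchangeCondition B B' = Σ[ P ∈ Subset n ] Σ[ v ∈ Fin n ] Σ[ v' ∈ Fin n ]
    P ∈ᶠ 𝓑 × v ∈ B × v ∉ B' × v' ∈ B' × v' ∉ B × B ⊂ P × B' ⊂ P ×
    (∀ C → C ∈ᶠ 𝓑 → Nonempty (B ∩ C) → C ⊆ P → C ⊈ B → v' ∈ C) ×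
    (∀ C' → C' ∈ᶠ 𝓑 → Nonempty (B' ∩ C') → C' ⊆ P → C' ⊈ B' → v ∈ C')

  -- Sufficiency: maximal nested sets from vertex orders

  orderBlocks : List (Fin n) → List (Subset n)
  orderBlocks [] = []
  orderBlocks (x ∷ xs) = component x (subsetOfList (x ∷ xs)) ∷ orderBlocks xs

  orderBlocks-⊆ : ∀ xs {Y} → Y ∈ˡ orderBlocks xs → Y ⊆ subsetOfList xs
  orderBlocks-⊆ (x ∷ xs) (here refl) = component-⊆
  orderBlocks-⊆ (x ∷ xs) (there Y∈) = q⊆p∪q ⁅ x ⁆ _ ∘ orderBlocks-⊆ xs Y∈

  orderBlocks-blocks : ∀ xs {Y} → Y ∈ˡ orderBlocks xs → Y ∈ᶠ 𝓑
  orderBlocks-blocks (x ∷ xs) (here refl) = component-block (x∈subsetOfList x xs)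
  orderBlocks-blocks (x ∷ xs) (there Y∈) = orderBlocks-blocks xs Y∈

  orderBlocks-cover : ∀ xs {z} → z ∈ˡ xs → Σ[ Y ∈ Subset n ] Y ∈ˡ orderBlocks xs × z ∈ Y
  orderBlocks-cover (x ∷ xs) (here refl) = _ , here refl , x∈component (x∈subsetOfList x xs)
  orderBlocks-cover (x ∷ xs) (there z∈xs) =
    let Y , Y∈ , z∈Y = orderBlocks-cover xs z∈xs in Y , there Y∈ , z∈Y

  later-block-⊆-or-disjoint : ∀ x xs {Y} → Y ∈ˡ orderBlocks xs →
    let K = component x (subsetOfList (x ∷ xs)) in Y ⊆ K ⊎ Disjoint Y K
  later-block-⊆-or-disjoint x xs {Y} Y∈ with nonempty? (Y ∩ component x (subsetOfList (x ∷ xs)))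
  ... | yes Y∩K≢∅ = inj₁ (component-absorbs (x∈subsetOfList x xs) (orderBlocks-blocks xs Y∈)
                                             (q⊆p∪q ⁅ x ⁆ _ ∘ orderBlocks-⊆ xs Y∈) Y∩K≢∅)
  ... | no Y∩K≡∅ = inj₂ Y∩K≡∅

  orderBlocks-laminar : ∀ xs {X Y} → X ∈ˡ orderBlocks xs → Y ∈ˡ orderBlocks xs →
                        X ⊆ Y ⊎ Y ⊆ X ⊎ Disjoint X Y
  orderBlocks-laminar (x ∷ xs) (here refl) (here refl) = inj₁ ⊆-refl
  orderBlocks-laminar (x ∷ xs) (here refl) (there Y∈) with later-block-⊆-or-disjoint x xs Y∈
  ... | inj₁ Y⊆X = inj₂ (inj₁ Y⊆X)
  ... | inj₂ Y∩X≡∅ = inj₂ (inj₂ (Disjoint-sym Y∩X≡∅))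
  orderBlocks-laminar (x ∷ xs) (there X∈) (here refl) with later-block-⊆-or-disjoint x xs X∈
  ... | inj₁ X⊆Y = inj₁ X⊆Y
  ... | inj₂ X∩Y≡∅ = inj₂ (inj₂ X∩Y≡∅)
  orderBlocks-laminar (x ∷ xs) (there X∈) (there Y∈) = orderBlocks-laminar xs X∈ Y∈

  orderBlocks-noCoveredBlock : ∀ xs → Unique xs → NoCoveredBlock (familyOf (orderBlocks xs))
  orderBlocks-noCoveredBlock [] _ U U∈𝓑 U-covered =
    let u , u∈U = blocks-nonempty U U∈𝓑
        Y , Y∈F , _ = U-covered u∈U
    in  case Y∈F of λ ()
  orderBlocks-noCoveredBlock (x ∷ xs) (x∉xs ∷ xs-unique) U U∈𝓑 U-covered with x ∈? U
  ... | no x∉U = orderBlocks-noCoveredBlock xs xs-unique U U∈𝓑 covered-by-later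
    where
    covered-by-later : CoveredBy (familyOf (orderBlocks xs)) U
    covered-by-later u∈U with U-covered u∈U
    ... | Y , Y∈F , (Y⊆U , Y≢U) , u∈Y with ∈-familyOf⁻ (orderBlocks (x ∷ xs)) Y∈F
    ...   | here refl = ⊥-elim (x∉U (Y⊆U (x∈component (x∈subsetOfList x xs))))
    ...   | there Y∈ = Y , ∈-familyOf⁺ Y∈ , (Y⊆U , Y≢U) , u∈Y
  ... | yes x∈U with U-covered x∈U
  ...   | Y , Y∈F , (Y⊆U , Y≢U) , x∈Y with ∈-familyOf⁻ (orderBlocks (x ∷ xs)) Y∈F
  ...     | here refl = Y≢U (⊆-antisym Y⊆U (component-maximal U∈𝓑 x∈U U⊆S))
    where
    U⊆S : U ⊆ subsetOfList (x ∷ xs)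
    U⊆S u∈U = let Z , Z∈F , (Z⊆U , _) , u∈Z = U-covered u∈U
              in  orderBlocks-⊆ (x ∷ xs) (∈-familyOf⁻ _ Z∈F) u∈Z
  ...     | there Y∈ = All.lookup x∉xs (∈-subsetOfList⁻ xs (orderBlocks-⊆ xs Y∈ x∈Y)) refl

  orderBlocks-κ : ∀ xs {K} → IsMaximalBlock 𝓑 K → K ⊆ subsetOfList xs → K ∈ˡ orderBlocks xs
  orderBlocks-κ [] (K∈𝓑 , _) K⊆∅ = let u , u∈K = blocks-nonempty _ K∈𝓑 in ⊥-elim (∉⊥ (K⊆∅ u∈K))
  orderBlocks-κ (x ∷ xs) {K} (K∈𝓑 , K-max) K⊆xxs with x ∈? K
  ... | yes x∈K = here (sym (K-max _ (component-block (x∈subsetOfList x xs)) (component-maximal K∈𝓑 x∈K K⊆xxs)))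
  ... | no x∉K = there (orderBlocks-κ xs (K∈𝓑 , K-max) (⊆-subsetOfList-drop {xs = xs} x∉K K⊆xxs))

  orderBlocks-saturated : ∀ xs → Unique xs → {F : Family n} → IsNested 𝓑 F →
    familyOf (orderBlocks xs) ⊆ᶠ F → ∀ {X} → X ∈ᶠ F → X ⊆ subsetOfList xs → X ∈ˡ orderBlocks xs
  orderBlocks-saturated [] _ F-nested _ {X} X∈F X⊆∅ =
    let u , u∈X = blocks-nonempty X (IsNested.sub𝓑 F-nested X X∈F) in ⊥-elim (∉⊥ (X⊆∅ u∈X))
  orderBlocks-saturated (x ∷ xs) (x∉xs ∷ xs-unique) {F} F-nested blocks⊆F {X} X∈F X⊆xxs with x ∈? X
  ... | no x∉X =
    there (orderBlocks-saturated xs xs-unique F-nested later-blocks⊆F X∈F (⊆-subsetOfList-drop {xs = xs} x∉X X⊆xxs))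
    where
    later-blocks⊆F : familyOf (orderBlocks xs) ⊆ᶠ F
    later-blocks⊆F Y Y∈ = blocks⊆F Y (∈-familyOf⁺ (there (∈-familyOf⁻ (orderBlocks xs) Y∈)))
  ... | yes x∈X with X ≟ˢ component x (subsetOfList (x ∷ xs))
  ...   | yes X≡K = here X≡K
  ...   | no X≢K = ⊥-elim (nested⇒noCoveredBlock F-nested K (component-block (x∈subsetOfList x xs)) K-covered)
    where
    K = component x (subsetOfList (x ∷ xs))
    X⊆K : X ⊆ K
    X⊆K = component-maximal (IsNested.sub𝓑 F-nested X X∈F) x∈X X⊆xxs
    K-covered : CoveredBy F K
    K-covered {z} z∈K with z ∈? X | ∈-subsetOfList⁻ (x ∷ xs) (component-⊆ z∈K)
    ... | yes z∈X | _ = X , X∈F , (X⊆K , X≢K) , z∈X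
    ... | no z∉X | here refl = ⊥-elim (z∉X x∈X)
    ... | no z∉X | there z∈xs with orderBlocks-cover xs z∈xs
    ...   | W , W∈ , z∈W = W , blocks⊆F W (∈-familyOf⁺ (there W∈)) , (W⊆K , W≢K) , z∈W
      where
      W⊆K : W ⊆ K
      W⊆K with later-block-⊆-or-disjoint x xs W∈
      ... | inj₁ W⊆K = W⊆K
      ... | inj₂ W∩K≡∅ = ⊥-elim (W∩K≡∅ (nonempty-∩ z∈W z∈K))
      W≢K : W ≢ K
      W≢K W≡K = All.lookup x∉xs (∈-subsetOfList⁻ xs (orderBlocks-⊆ xs W∈
                  (subst (x ∈_) (sym W≡K) (x∈component (x∈subsetOfList x xs))))) refl

  orderNested : List (Fin n) → Family n
  orderNested σ = familyOf (orderBlocks σ)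

  orderNested-maximal : ∀ σ → Unique σ → (∀ z → z ∈ˡ σ) → IsMaximalNested 𝓑 (orderNested σ)
  orderNested-maximal σ σ-unique σ-complete = nested , saturated
    where
    everything⊆σ : ∀ {X} → X ⊆ subsetOfList σ
    everything⊆σ {_} {z} _ = ∈-subsetOfList⁺ (σ-complete z)

    nested : IsNested 𝓑 (orderNested σ)
    nested = noCoveredBlock⇒nested
      (λ X X∈ → orderBlocks-blocks σ (∈-familyOf⁻ _ X∈))
      (λ X Y X∈ Y∈ → orderBlocks-laminar σ (∈-familyOf⁻ _ X∈) (∈-familyOf⁻ _ Y∈))
      (orderBlocks-noCoveredBlock σ σ-unique)
      (λ K K-max → ∈-familyOf⁺ (orderBlocks-κ σ K-max everything⊆σ))

    saturated : ∀ F → IsNested 𝓑 F → orderNested σ ⊆ᶠ F → F ⊆ᶠ orderNested σ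
    saturated F F-nested σ⊆F X X∈F = ∈-familyOf⁺ (orderBlocks-saturated σ σ-unique F-nested σ⊆F X∈F everything⊆σ)

  prefixBlocks : List (Fin n) → Subset n → List (Subset n)
  prefixBlocks [] S = []
  prefixBlocks (q ∷ Q) S = component q (⁅ q ⁆ ∪ (Q ++ˢ S)) ∷ prefixBlocks Q S

  orderBlocks-++ : ∀ Q ys → orderBlocks (Q ++ ys) ≡ prefixBlocks Q (subsetOfList ys) ++ orderBlocks ys
  orderBlocks-++ [] ys = refl
  orderBlocks-++ (q ∷ Q) ys =
    cong₂ _∷_ (cong (component q ∘ (⁅ q ⁆ ∪_)) (subsetOfList-++ Q ys)) (orderBlocks-++ Q ys)

  prefixBlock-meets : ∀ Q {S X} → X ∈ˡ prefixBlocks Q S → Σ[ q ∈ Fin n ] q ∈ˡ Q × q ∈ X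
  prefixBlock-meets (q ∷ Q) (here refl) = q , here refl , x∈component (p⊆p∪q _ (x∈⁅x⁆ q))
  prefixBlock-meets (q ∷ Q) (there X∈) = let q' , q'∈Q , q'∈X = prefixBlock-meets Q X∈ in q' , there q'∈Q , q'∈X

  module TranspositionSide
    (P B : Subset n) (v v' : Fin n) (Q R : List (Fin n))
    (P∈𝓑 : P ∈ᶠ 𝓑) (B∈𝓑 : B ∈ᶠ 𝓑) (B⊆P : B ⊆ P) (v∈B : v ∈ B) (v'∈P : v' ∈ P) (v'∉B : v' ∉ B)
    (B-condition : ∀ C → C ∈ᶠ 𝓑 → Nonempty (B ∩ C) → C ⊆ P → C ⊈ B → v' ∈ C)
    (Q-unique : Unique Q) (R-unique : Unique R)
    (Q-outside : ∀ {z} → z ∈ˡ Q → z ∉ P) (outside-Q : ∀ {z} → z ∉ P → z ∈ˡ Q)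
    (R-inside : ∀ {z} → z ∈ˡ R → z ∈ P × z ≢ v × z ≢ v')
    (inside-R : ∀ {z} → z ∈ P → z ≢ v → z ≢ v' → z ∈ˡ R)
    where

    σ : List (Fin n)
    σ = Q ++ v' ∷ v ∷ R

    v∈P : v ∈ P
    v∈P = B⊆P v∈B

    v≢v' : v ≢ v'
    v≢v' refl = v'∉B v∈B

    R⊆P : subsetOfList R ⊆ P
    R⊆P z∈R = proj₁ (R-inside (∈-subsetOfList⁻ R z∈R))

    inside-vvR : ∀ {z} → z ∈ P → z ∈ˡ v' ∷ v ∷ R
    inside-vvR {z} z∈P with z ≟ v' | z ≟ v
    ... | yes refl | _ = here refl
    ... | no _ | yes refl = there (here refl)
    ... | no z≢v' | no z≢v = there (there (inside-R z∈P z≢v z≢v'))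

    vvR≡P : subsetOfList (v' ∷ v ∷ R) ≡ P
    vvR≡P = ⊆-antisym (∪-least (⁅x⁆⊆ v'∈P) (∪-least (⁅x⁆⊆ v∈P) R⊆P))
                      (∈-subsetOfList⁺ ∘ inside-vvR)

    component-v≡B : component v (subsetOfList (v ∷ R)) ≡ B
    component-v≡B = ⊆-antisym K⊆B (component-maximal B∈𝓑 v∈B B⊆vR)
      where
      K = component v (subsetOfList (v ∷ R))
      vR⊆P : subsetOfList (v ∷ R) ⊆ P
      vR⊆P = ∪-least (⁅x⁆⊆ v∈P) R⊆P
      v'∉vR : v' ∉ subsetOfList (v ∷ R)
      v'∉vR v'∈vR with ∈-subsetOfList⁻ (v ∷ R) v'∈vR
      ... | here v'≡v = v≢v' (sym v'≡v)
      ... | there v'∈R = proj₂ (proj₂ (R-inside v'∈R)) refl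
      B⊆vR : B ⊆ subsetOfList (v ∷ R)
      B⊆vR {z} z∈B with z ≟ v
      ... | yes refl = x∈subsetOfList v R
      ... | no z≢v = ∈-subsetOfList⁺ (there (inside-R (B⊆P z∈B) z≢v λ { refl → v'∉B z∈B }))
      K⊆B : K ⊆ B
      K⊆B = decidable-stable (K ⊆? B) λ K⊈B →
        v'∉vR (component-⊆ (B-condition K (component-block (x∈subsetOfList v R))
          (nonempty-∩ v∈B (x∈component (x∈subsetOfList v R))) (⊆-trans component-⊆ vR⊆P) K⊈B))

    orderBlocks-σ : orderBlocks σ ≡ (prefixBlocks Q P ∷ʳ P) ++ B ∷ orderBlocks R
    orderBlocks-σ = begin
      orderBlocks (Q ++ v' ∷ v ∷ R)
        ≡⟨ orderBlocks-++ Q (v' ∷ v ∷ R) ⟩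
      prefixBlocks Q S ++ component v' S ∷ component v (subsetOfList (v ∷ R)) ∷ orderBlocks R
        ≡⟨ cong₂ (λ T K → prefixBlocks Q T ++ component v' T ∷ K ∷ orderBlocks R) vvR≡P component-v≡B ⟩
      prefixBlocks Q P ++ component v' P ∷ B ∷ orderBlocks R
        ≡⟨ cong (λ K → prefixBlocks Q P ++ K ∷ B ∷ orderBlocks R) (component-of-block P∈𝓑 v'∈P) ⟩
      prefixBlocks Q P ++ P ∷ B ∷ orderBlocks R
        ≡⟨ ++-assoc (prefixBlocks Q P) (P ∷ []) (B ∷ orderBlocks R) ⟨
      (prefixBlocks Q P ∷ʳ P) ++ B ∷ orderBlocks R ∎
      where
      open ≡-Reasoning
      S = subsetOfList (v' ∷ v ∷ R)

    σ-unique : Unique σ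
    σ-unique = ++⁺ Q-unique vvR-unique Q∩vvR≡∅
      where
      vvR-unique : Unique (v' ∷ v ∷ R)
      vvR-unique = ((v≢v' ∘ sym) ∷ All.tabulate (λ z∈R v'≡z → proj₂ (proj₂ (R-inside z∈R)) (sym v'≡z)))
                 ∷ All.tabulate (λ z∈R v≡z → proj₁ (proj₂ (R-inside z∈R)) (sym v≡z)) ∷ R-unique
      Q∩vvR≡∅ : ∀ {z} → ¬ (z ∈ˡ Q × z ∈ˡ v' ∷ v ∷ R)
      Q∩vvR≡∅ (z∈Q , z∈vvR) = Q-outside z∈Q (subst (_ ∈_) vvR≡P (∈-subsetOfList⁺ z∈vvR))

    σ-complete : ∀ z → z ∈ˡ σ
    σ-complete z with z ∈? P
    ... | yes z∈P = ∈-++⁺ʳ Q (inside-vvR z∈P)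
    ... | no z∉P = ∈-++⁺ˡ (outside-Q z∉P)

  module Transposition (P : Subset n) (v v' : Fin n) where
    outside? : Decidable (_∉ P)
    outside? z = ¬? (z ∈? P)

    others? : Decidable λ z → z ∈ P × z ≢ v × z ≢ v'
    others? z = z ∈? P ×-dec ¬? (z ≟ v) ×-dec ¬? (z ≟ v')

    Q R : List (Fin n)
    Q = filter outside? (allFin n)
    R = filter others? (allFin n)

    Q-unique : Unique Q
    Q-unique = filter⁺ outside? (allFin⁺ n)

    R-unique : Unique R
    R-unique = filter⁺ others? (allFin⁺ n)

    Q-outside : ∀ {z} → z ∈ˡ Q → z ∉ P
    Q-outside = proj₂ ∘ ∈-filter⁻ outside? {xs = allFin n}

    outside-Q : ∀ {z} → z ∉ P → z ∈ˡ Q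
    outside-Q = ∈-filter⁺ outside? (∈-allFin _)

    R-inside : ∀ {z} → z ∈ˡ R → z ∈ P × z ≢ v × z ≢ v'
    R-inside = proj₂ ∘ ∈-filter⁻ others? {xs = allFin n}

    inside-R : ∀ {z} → z ∈ P → z ≢ v → z ≢ v' → z ∈ˡ R
    inside-R z∈P z≢v z≢v' = ∈-filter⁺ others? (∈-allFin _) (z∈P , z≢v , z≢v')

    R-inside' : ∀ {z} → z ∈ˡ R → z ∈ P × z ≢ v' × z ≢ v
    R-inside' z∈R = let z∈P , z≢v , z≢v' = R-inside z∈R in z∈P , z≢v' , z≢v

    inside-R' : ∀ {z} → z ∈ P → z ≢ v' → z ≢ v → z ∈ˡ R
    inside-R' z∈P z≢v' z≢v = inside-R z∈P z≢v z≢v'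

    common : List (Subset n)
    common = prefixBlocks Q P ∷ʳ P

    ∉common : ∀ {X w} → X ⊂ P → w ∈ X → (∀ {z} → z ∈ˡ R → z ≢ w) → ¬ X ∈ˡ common ++ orderBlocks R
    ∉common {X} X⊂P w∈X w∉R X∈ with ∈-++⁻ common X∈
    ... | inj₂ X∈R = w∉R (∈-subsetOfList⁻ R (orderBlocks-⊆ R X∈R w∈X)) refl
    ... | inj₁ X∈common with ∈-++⁻ (prefixBlocks Q P) X∈common
    ...   | inj₁ X∈prefix = let q , q∈Q , q∈X = prefixBlock-meets Q X∈prefix in Q-outside q∈Q (proj₁ X⊂P q∈X)
    ...   | inj₂ (here refl) = proj₂ (⊂⇒⊊ X⊂P) refl

    exchange : ∀ {σ σ' b b'} →
      orderBlocks σ ≡ common ++ b ∷ orderBlocks R → orderBlocks σ' ≡ common ++ b' ∷ orderBlocks R →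
      ¬ b' ∈ˡ common ++ orderBlocks R →
      ∀ X → (X ∈ᶠ orderNested σ × X ≢ b) → X ∈ᶠ orderNested σ' × X ≢ b'
    exchange {σ} blocks-σ blocks-σ' b'∉ X (X∈ , X≢b) =
      let X∈' , X≢b' = ∈-swap common (orderBlocks R) b'∉
                           (subst (X ∈ˡ_) blocks-σ (∈-familyOf⁻ (orderBlocks σ) X∈)) X≢b
      in  ∈-familyOf⁺ (subst (X ∈ˡ_) (sym blocks-σ') X∈') , X≢b'

  condition⇒exchangeable : ∀ {B B'} → B ∈ᶠ 𝓑 → B' ∈ᶠ 𝓑 → ExchangeCondition B B' → Exchangeable 𝓑 B B'
  condition⇒exchangeable {B} {B'} B∈𝓑 B'∈𝓑
    (P , v , v' , P∈𝓑 , v∈B , v∉B' , v'∈B' , v'∉B , B⊂P , B'⊂P , B-condition , B'-condition) =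
    orderNested S.σ , orderNested S'.σ ,
    orderNested-maximal S.σ S.σ-unique S.σ-complete , orderNested-maximal S'.σ S'.σ-unique S'.σ-complete ,
    ∈-familyOf⁺ (subst (B ∈ˡ_) (sym S.orderBlocks-σ) (∈-++⁺ʳ common (here refl))) ,
    ∈-familyOf⁺ (subst (B' ∈ˡ_) (sym S'.orderBlocks-σ) (∈-++⁺ʳ common (here refl))) ,
    (λ X → mk⇔ (exchange S.orderBlocks-σ S'.orderBlocks-σ B'∉common X)
               (exchange S'.orderBlocks-σ S.orderBlocks-σ B∉common X)) ,
    λ { refl → v∉B' v∈B }
    where
    open Transposition P v v'
    module S = TranspositionSide P B v v' Q R P∈𝓑 B∈𝓑 (proj₁ B⊂P) v∈B (proj₁ B'⊂P v'∈B') v'∉B B-condition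
      Q-unique R-unique Q-outside outside-Q R-inside inside-R
    module S' = TranspositionSide P B' v' v Q R P∈𝓑 B'∈𝓑 (proj₁ B'⊂P) v'∈B' (proj₁ B⊂P v∈B) v∉B' B'-condition
      Q-unique R-unique Q-outside outside-Q R-inside' inside-R'

    B'∉common : ¬ B' ∈ˡ common ++ orderBlocks R
    B'∉common = ∉common B'⊂P v'∈B' λ z∈R → proj₂ (proj₂ (R-inside z∈R))

    B∉common : ¬ B ∈ˡ common ++ orderBlocks R
    B∉common = ∉common B⊂P v∈B λ z∈R → proj₁ (proj₂ (R-inside z∈R))

  -- Necessity

  module ExchangeSide {𝓝 𝓝' : Family n} {B B' : Subset n}
    (𝓝-max : IsMaximalNested 𝓑 𝓝) (𝓝'-max : IsMaximalNested 𝓑 𝓝')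
    (B∈𝓝 : B ∈ᶠ 𝓝) (B'∈𝓝' : B' ∈ᶠ 𝓝')
    (same : ∀ X → (X ∈ᶠ 𝓝 × X ≢ B) ⇔ (X ∈ᶠ 𝓝' × X ≢ B')) (B≢B' : B ≢ B')
    where
    open IsNested (proj₁ 𝓝-max)
    open IsNested (proj₁ 𝓝'-max) using ()
      renaming (sub𝓑 to sub𝓑' ; nested-or-disjoint to nested-or-disjoint' ; contains-κ to contains-κ')

    B∈𝓑 : B ∈ᶠ 𝓑
    B∈𝓑 = sub𝓑 B B∈𝓝

    to-𝓝' : ∀ {X} → X ∈ᶠ 𝓝 → X ≢ B → X ∈ᶠ 𝓝'
    to-𝓝' X∈𝓝 X≢B = proj₁ (Equivalence.to (same _) (X∈𝓝 , X≢B))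

    to-𝓝 : ∀ {X} → X ∈ᶠ 𝓝' → X ≢ B' → X ∈ᶠ 𝓝
    to-𝓝 X∈𝓝' X≢B' = proj₁ (Equivalence.from (same _) (X∈𝓝' , X≢B'))

    B∉𝓝' : ¬ B ∈ᶠ 𝓝'
    B∉𝓝' B∈𝓝' = proj₂ (Equivalence.from (same B) (B∈𝓝' , B≢B')) refl

    IsParent : Subset n → Set
    IsParent P = P ∈ᶠ 𝓝 × B ⊊ P × (∀ Z → Z ∈ᶠ 𝓝 → B ⊊ Z → P ⊆ Z)

    parent-exists : Σ[ P ∈ Subset n ] IsParent P
    parent-exists with maximalBlock-above B∈𝓑
    ... | K , B⊆K , K-maxblock with minimal-below (λ Z → Z ∈ᶠ? 𝓝 ×-dec B ⊊? Z)
                                      (contains-κ K K-maxblock , B⊆K , λ { refl → B∉𝓝' (contains-κ' K K-maxblock) })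
    ...   | P , _ , (P∈𝓝 , B⊊P) , P-min = P , P∈𝓝 , B⊊P , P-below
      where
      P-below : ∀ Z → Z ∈ᶠ 𝓝 → B ⊊ Z → P ⊆ Z
      P-below Z Z∈𝓝 B⊊Z with nested-or-disjoint Z P Z∈𝓝 P∈𝓝
      ... | inj₁ Z⊆P = P-min Z (Z∈𝓝 , B⊊Z) Z⊆P
      ... | inj₂ (inj₁ P⊆Z) = P⊆Z
      ... | inj₂ (inj₂ Z∩P≡∅) = let b , b∈B = blocks-nonempty B B∈𝓑
                                in  ⊥-elim (Z∩P≡∅ (nonempty-∩ (proj₁ B⊊Z b∈B) (proj₁ B⊊P b∈B)))

    B'⊆parent : ∀ {P} → IsParent P → B' ⊆ P
    B'⊆parent {P} (P∈𝓝 , (B⊆P , B≢P) , _) = decidable-stable (B' ⊆? P) λ B'⊈P →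
      B∉𝓝' (maximal-absorbs 𝓝'-max
        (insert-nested (proj₁ 𝓝'-max) B∈𝓑 (B-laminar (position B'⊈P)) (B-uncovering (position B'⊈P))))
      where
      P∈𝓝' : P ∈ᶠ 𝓝'
      P∈𝓝' = to-𝓝' P∈𝓝 (B≢P ∘ sym)

      position : B' ⊈ P → P ⊆ B' ⊎ Disjoint B' P
      position B'⊈P with nested-or-disjoint' B' P B'∈𝓝' P∈𝓝'
      ... | inj₁ B'⊆P = ⊥-elim (B'⊈P B'⊆P)
      ... | inj₂ P⊆B'-or-disjoint = P⊆B'-or-disjoint

      B-laminar : P ⊆ B' ⊎ Disjoint B' P → ∀ Y → Y ∈ᶠ 𝓝' → B ⊆ Y ⊎ Y ⊆ B ⊎ Disjoint B Y
      B-laminar P⊆B'-or-disjoint Y Y∈𝓝' with Y ≟ˢ B' | P⊆B'-or-disjoint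
      ... | no Y≢B' | _ = nested-or-disjoint B Y B∈𝓝 (to-𝓝 Y∈𝓝' Y≢B')
      ... | yes refl | inj₁ P⊆Y = inj₁ (⊆-trans B⊆P P⊆Y)
      ... | yes refl | inj₂ Y∩P≡∅ = inj₂ (inj₂ (Disjoint-sym (Y∩P≡∅ ∘ ∩-nonempty-monoʳ B⊆P)))

      B-uncovering : P ⊆ B' ⊎ Disjoint B' P → ∀ U → U ∈ᶠ 𝓑 → B ⊊ U → ¬ CoveredBy (𝓝' ∪ᶠ B) U
      B-uncovering P⊆B'-or-disjoint U U∈𝓑 (B⊆U , _) U-covered with B' ⊊? U | P⊆B'-or-disjoint
      ... | no ¬B'⊊U | _ = nested⇒noCoveredBlock (proj₁ 𝓝-max) U U∈𝓑 (CoveredBy-mono members-in-𝓝 U-covered)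
        where
        members-in-𝓝 : ∀ {Y} → Y ∈ᶠ 𝓝' ∪ᶠ B → Y ⊊ U → Y ∈ᶠ 𝓝
        members-in-𝓝 Y∈ Y⊊U with ∈-∪ᶠ⁻ {F = 𝓝'} Y∈
        ... | inj₁ Y∈𝓝' = to-𝓝 Y∈𝓝' λ { refl → ¬B'⊊U Y⊊U }
        ... | inj₂ refl = B∈𝓝
      ... | yes B'⊊U | inj₁ P⊆B' = nested⇒noCoveredBlock (proj₁ 𝓝'-max) U U∈𝓑
                                     (enlarge-inserted (λ _ → B' , B'∈𝓝' , B'⊊U , ⊆-trans B⊆P P⊆B') U-covered)
      ... | yes (B'⊆U , _) | inj₂ B'∩P≡∅ =
        let b , b∈B = blocks-nonempty B B∈𝓑
            b' , b'∈B' = blocks-nonempty B' (sub𝓑' B' B'∈𝓝')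
        in  nested⇒noCoveredBlock (proj₁ 𝓝'-max) (U ∪ P)
              (union-closed U P U∈𝓑 (sub𝓑 P P∈𝓝) (nonempty-∩ (B⊆U b∈B) (B⊆P b∈B)))
              (covered-∪ P∈𝓝' B⊆P (λ U⊆P → B'∩P≡∅ (nonempty-∩ b'∈B' (U⊆P (B'⊆U b'∈B')))) U-covered)

    ∈-𝓝∖B⁺ : ∀ {Y} → Y ∈ᶠ 𝓝 → Y ≢ B → Y ∈ᶠ 𝓝 ∖ᶠ B
    ∈-𝓝∖B⁺ = ∈-∖ᶠ⁺ {F = 𝓝}

    ∈-𝓝∖B⁻ : ∀ {Y} → Y ∈ᶠ 𝓝 ∖ᶠ B → Y ∈ᶠ 𝓝 × Y ≢ B
    ∈-𝓝∖B⁻ = ∈-∖ᶠ⁻ {F = 𝓝}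

    module Labelled {P : Subset n} (P-parent : IsParent P) {v p : Fin n}
                    (v-label : IsLabel 𝓝 B v) (p-label : IsLabel 𝓝 P p) where
      P∈𝓝 = proj₁ P-parent
      B⊆P = proj₁ (proj₁ (proj₂ P-parent))
      v∈B = proj₁ v-label

      Free : Fin n → Set
      Free = IsLabel (𝓝 ∖ᶠ B) P

      free-cases : ∀ {z} → Free z → z ≡ p ⊎ z ≡ v
      free-cases {z} (z∈P , z-free) with z ∈? B
      ... | yes z∈B = inj₂ (label-unique 𝓝-max B∈𝓝 (z∈B , λ (Y , Y∈𝓝 , Y⊊B , z∈Y) →
                        z-free (Y , ∈-𝓝∖B⁺ Y∈𝓝 (proj₂ Y⊊B) , ⊊-⊆-trans Y⊊B B⊆P , z∈Y)) v-label)
      ... | no z∉B = inj₁ (label-unique 𝓝-max P∈𝓝 (z∈P , λ (Y , Y∈𝓝 , Y⊊P , z∈Y) →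
                        z-free (Y , ∈-𝓝∖B⁺ Y∈𝓝 (λ { refl → z∉B z∈Y }) , Y⊊P , z∈Y)) p-label)

      p-free : Free p
      p-free = proj₁ p-label , λ (Y , Y∈ , Y⊊P , p∈Y) → proj₂ p-label (Y , proj₁ (∈-𝓝∖B⁻ Y∈) , Y⊊P , p∈Y)

      v-free : Free v
      v-free = B⊆P v∈B , λ (Y , Y∈ , Y⊊P , v∈Y) → v-avoids Y (∈-𝓝∖B⁻ Y∈) Y⊊P v∈Y
        where
        v-avoids : ∀ Y → Y ∈ᶠ 𝓝 × Y ≢ B → Y ⊊ P → v ∉ Y
        v-avoids Y (Y∈𝓝 , Y≢B) (Y⊆P , Y≢P) v∈Y with nested-or-disjoint Y B Y∈𝓝 B∈𝓝
        ... | inj₁ Y⊆B = proj₂ v-label (Y , Y∈𝓝 , (Y⊆B , Y≢B) , v∈Y)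
        ... | inj₂ (inj₁ B⊆Y) = Y≢P (⊆-antisym Y⊆P (proj₂ (proj₂ P-parent) Y Y∈𝓝 (B⊆Y , Y≢B ∘ sym)))
        ... | inj₂ (inj₂ Y∩B≡∅) = Y∩B≡∅ (nonempty-∩ v∈Y v∈B)

      p∉B : p ∉ B
      p∉B p∈B = proj₂ p-label (B , B∈𝓝 , proj₁ (proj₂ P-parent) , p∈B)

      condition : ∀ C → C ∈ᶠ 𝓑 → Nonempty (B ∩ C) → C ⊆ P → C ⊈ B → p ∈ C
      condition C C∈𝓑 B∩C≢∅ C⊆P C⊈B = decidable-stable (p ∈? C) λ p∉C →
        nested⇒noCoveredBlock (proj₁ 𝓝-max) D (component-block v∈P-p) (D-covered p∉C)
        where
        v∈P-p : v ∈ P - p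
        v∈P-p = x∈p∧x≢y⇒x∈p-y (B⊆P v∈B) λ { refl → p∉B v∈B }

        D : Subset n
        D = component v (P - p)

        D-covered : p ∉ C → CoveredBy 𝓝 D
        D-covered p∉C {w} w∈D with w ∈? B
        ... | yes w∈B = B , B∈𝓝 , (⊆-trans (q⊆p∪q C B) C∪B⊆D , B≢D) , w∈B
          where
          C∪B⊆D : C ∪ B ⊆ D
          C∪B⊆D = component-maximal (union-closed C B C∈𝓑 B∈𝓑 (∩-nonempty-comm B∩C≢∅)) (q⊆p∪q C B v∈B)
                    (∪-least (⊆-remove C⊆P p∉C) (⊆-remove B⊆P p∉B))
          B≢D : B ≢ D
          B≢D B≡D = C⊈B (subst (C ⊆_) (sym B≡D) (⊆-trans (p⊆p∪q B) C∪B⊆D))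
        ... | no w∉B with nonLabel-covered (p─q⊆p P ⁅ p ⁆ w∈P-p) w-not-free
          where
          w∈P-p = component-⊆ w∈D
          w-not-free : ¬ Free w
          w-not-free w-free with free-cases w-free
          ... | inj₁ refl = x∈p─q⇒x∉q P ⁅ p ⁆ w∈P-p (x∈⁅x⁆ p)
          ... | inj₂ refl = w∉B v∈B
        ...   | Y , Y∈ , Y⊊P , w∈Y =
          Y , Y∈𝓝 , (Y⊆D , λ { refl → proj₂ v-free (Y , Y∈ , Y⊊P , x∈component v∈P-p) }) , w∈Y
          where
          Y∈𝓝 = proj₁ (∈-𝓝∖B⁻ Y∈)
          Y⊆D : Y ⊆ D
          Y⊆D = component-absorbs v∈P-p (sub𝓑 Y Y∈𝓝)
                  (⊆-remove (proj₁ Y⊊P) λ p∈Y → proj₂ p-label (Y , Y∈𝓝 , Y⊊P , p∈Y)) (nonempty-∩ w∈Y w∈D)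

    parent-below : ∀ {P Q} → IsParent P → Q ∈ᶠ 𝓝' → B' ⊊ Q → B ⊆ Q → P ⊆ Q
    parent-below (_ , _ , P-min) Q∈𝓝' (_ , B'≢Q) B⊆Q =
      P-min _ (to-𝓝 Q∈𝓝' (B'≢Q ∘ sym)) (B⊆Q , λ { refl → B∉𝓝' Q∈𝓝' })

    common-label : ∀ {X z} → IsLabel (𝓝' ∖ᶠ B') X z → IsLabel (𝓝 ∖ᶠ B) X z
    common-label (z∈X , z-free) = z∈X , λ (Y , Y∈ , Y⊊X , z∈Y) →
      z-free (Y , uncurry (∈-∖ᶠ⁺ {F = 𝓝'}) (Equivalence.to (same Y) (∈-𝓝∖B⁻ Y∈)) , Y⊊X , z∈Y)

    label-not-shared : ∀ {w} → IsLabel 𝓝 B w → IsLabel 𝓝' B' w → B' ⊈ B → ⊥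
    label-not-shared {w} (w∈B , _) w-label' B'⊈B =
      union-not-covered (proj₁ 𝓝-max) B∈𝓝 (sub𝓑' B' B'∈𝓝') w∈B (proj₁ w-label') B'⊈B λ x∈B' x∉B →
        InProperMember-mono (λ Y∈𝓝' Y⊊B' → to-𝓝 Y∈𝓝' (proj₂ Y⊊B'))
          (nonLabel-covered x∈B' λ x-label' →
            x∉B (subst (_∈ B) (sym (label-unique 𝓝'-max B'∈𝓝' x-label' w-label')) w∈B))

  module Exchanged {𝓝 𝓝' : Family n} {B B' : Subset n}
    (𝓝-max : IsMaximalNested 𝓑 𝓝) (𝓝'-max : IsMaximalNested 𝓑 𝓝')
    (B∈𝓝 : B ∈ᶠ 𝓝) (B'∈𝓝' : B' ∈ᶠ 𝓝')
    (same : ∀ X → (X ∈ᶠ 𝓝 × X ≢ B) ⇔ (X ∈ᶠ 𝓝' × X ≢ B')) (B≢B' : B ≢ B')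
    where
    module S = ExchangeSide 𝓝-max 𝓝'-max B∈𝓝 B'∈𝓝' same B≢B'
    module S' = ExchangeSide 𝓝'-max 𝓝-max B'∈𝓝' B∈𝓝 (⇔-sym ∘ same) (B≢B' ∘ sym)

    module WithLabels {P P' : Subset n} (P-parent : S.IsParent P) (P'-parent : S'.IsParent P')
                  {v p v' p' : Fin n} (v-label : IsLabel 𝓝 B v) (p-label : IsLabel 𝓝 P p)
                  (v'-label : IsLabel 𝓝' B' v') (p'-label : IsLabel 𝓝' P' p') where
      module L = S.Labelled P-parent v-label p-label
      module L' = S'.Labelled P'-parent v'-label p'-label

      P≡P' : P ≡ P'
      P≡P' = ⊆-antisym
        (S.parent-below P-parent (proj₁ P'-parent) (proj₁ (proj₂ P'-parent)) (S'.B'⊆parent P'-parent))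
        (S'.parent-below P'-parent (proj₁ P-parent) (proj₁ (proj₂ P-parent)) (S.B'⊆parent P-parent))

      free'⇒free : ∀ {z} → L'.Free z → L.Free z
      free'⇒free {z} = S.common-label ∘ subst (λ X → IsLabel (𝓝' ∖ᶠ B') X z) (sym P≡P')

      v'≢v : v' ≢ v
      v'≢v v'≡v with B' ⊆? B
      ... | no B'⊈B = S.label-not-shared v-label (subst (IsLabel 𝓝' B') v'≡v v'-label) B'⊈B
      ... | yes B'⊆B = S'.label-not-shared v'-label (subst (IsLabel 𝓝 B) (sym v'≡v) v-label)
                         λ B⊆B' → B≢B' (⊆-antisym B⊆B' B'⊆B)

      v'≡p : v' ≡ p
      v'≡p with L.free-cases (free'⇒free L'.v-free)
      ... | inj₁ v'≡p = v'≡p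
      ... | inj₂ v'≡v = ⊥-elim (v'≢v v'≡v)

      p'≡v : p' ≡ v
      p'≡v with L.free-cases (free'⇒free L'.p-free)
      ... | inj₂ p'≡v = p'≡v
      ... | inj₁ p'≡p = ⊥-elim (L'.p∉B (subst (_∈ B') (trans v'≡p (sym p'≡p)) (proj₁ v'-label)))

      condition-holds : ExchangeCondition B B'
      condition-holds =
        P , v , v' , IsNested.sub𝓑 (proj₁ 𝓝-max) P (proj₁ P-parent) , L.v∈B , subst (_∉ B') p'≡v L'.p∉B ,
        proj₁ v'-label , subst (_∉ B) (sym v'≡p) L.p∉B ,
        ⊊⇒⊂ (proj₁ (proj₂ P-parent)) , ⊊⇒⊂ (subst (B' ⊊_) (sym P≡P') (proj₁ (proj₂ P'-parent))) ,
        (λ C C∈𝓑 B∩C≢∅ C⊆P C⊈B → subst (_∈ C) (sym v'≡p) (L.condition C C∈𝓑 B∩C≢∅ C⊆P C⊈B)) ,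
        (λ C C∈𝓑 B'∩C≢∅ C⊆P C⊈B' →
          subst (_∈ C) p'≡v (L'.condition C C∈𝓑 B'∩C≢∅ (subst (C ⊆_) P≡P' C⊆P) C⊈B'))

    condition-holds : ExchangeCondition B B'
    condition-holds =
      let P , P-parent = S.parent-exists
          P' , P'-parent = S'.parent-exists
      in  WithLabels.condition-holds P-parent P'-parent
            (proj₂ (label-exists (proj₁ 𝓝-max) B∈𝓝)) (proj₂ (label-exists (proj₁ 𝓝-max) (proj₁ P-parent)))
            (proj₂ (label-exists (proj₁ 𝓝'-max) B'∈𝓝')) (proj₂ (label-exists (proj₁ 𝓝'-max) (proj₁ P'-parent)))

  exchangeable⇒condition : ∀ {B B'} → Exchangeable 𝓑 B B' → ExchangeCondition B B'
  exchangeable⇒condition (_ , _ , 𝓝-max , 𝓝'-max , B∈𝓝 , B'∈𝓝' , same , B≢B') =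
    Exchanged.condition-holds 𝓝-max 𝓝'-max B∈𝓝 B'∈𝓝' same B≢B'

proposition3p13 : (n : ℕ) (𝓑 : Family n) → IsBuildingSet 𝓑 →
    (B B' : Subset n) → B ∈ᶠ 𝓑 → B' ∈ᶠ 𝓑 →
    Exchangeable 𝓑 B B' ⇔
      (Σ (Subset n) λ P → ∃ λ v → ∃ λ v' →
        P ∈ᶠ 𝓑 × v ∈ B × v ∉ B' × v' ∈ B' × v' ∉ B ×
        B ⊂ P × B' ⊂ P ×
        (∀ C → C ∈ᶠ 𝓑 → Nonempty (B ∩ C) → C ⊆ P → C ⊈ B → v' ∈ C) ×
        (∀ C' → C' ∈ᶠ 𝓑 → Nonempty (B' ∩ C') → C' ⊆ P → C' ⊈ B' → v ∈ C'))
proposition3p13 n 𝓑 𝓑-building B B' B∈𝓑 B'∈𝓑 =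
  mk⇔ exchangeable⇒condition (condition⇒exchangeable B∈𝓑 B'∈𝓑)
  where open BuildingSetFacts 𝓑 𝓑-building
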